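{- Let $\sigma\in S_k$ for some $k\geq 3$. If $\widehat\sigma$ contains $231$ classically, then $\operatorname{Sort}(\operatorname{SC}_\sigma)$ equals the set of permutations that avoid $132$ classically and avoid $\operatorname{rev}(\sigma)$ consecutively.
   Context: $S_n$ is the set of permutations of $[n]$ in one-line notation. Two sequences of distinct integers have the same relative order if replacing the $i$th smallest entry of each by $i$ yields the same word. A permutation $\tau$ contains $\sigma$ classically if some (not necessarily consecutive) subsequence of $\tau$ has the same relative order as $\sigma$, and consecutively if some consecutive subsequence does; otherwise $\tau$ avoids $\sigma$ classically/consecutively. For a set $\mathcal A$ of permutations, $T_{\mathcal A}:S_n\to S_n$ is defined by sending $\pi$ through a stack: at each step, if there is a next input entry and placing it on top of the stack would make the stack contents, read top to bottom, have the same relative order as some element of $\mathcal A$, push it; otherwise pop the top entry of the stack to the end of the output; stop when the output has length $n$. $\operatorname{SC}_\sigma=T_{\mathcal A}$ with $\mathcal A$ the set of permutations avoiding $\sigma$ consecutively. $\operatorname{Sort}(\operatorname{SC}_\sigma)$ is the set of permutations $\pi$ (of any length) such that $\operatorname{SC}_\sigma(\pi)$ avoids $231$ classically. For $\sigma=\sigma_1\cdots\sigma_k$, $\widehat\sigma=\sigma_2\sigma_1\sigma_3\cdots\sigma_k$ and $\operatorname{rev}(\sigma)=\sigma_k\cdots\sigma_1$. -}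

module Defs where

open import Data.Nat using (ℕ; zero; suc; _+_; _*_; _≤?_; _≡ᵇ_)
open import Data.Bool using (Bool; true; false; if_then_else_; not; _∧_)
open import Data.List using (List; []; _∷_; _++_; length; filter; map; upTo)
open import Data.Bool.ListAction using (any)
open import Data.List.Relation.Binary.Sublist.Propositional using (_⊆_)
open import Data.List.Relation.Binary.Permutation.Propositional using (_↭_)
open import Data.Product using (Σ; _×_; ∃; ∃-syntax)
open import Relation.Binary.PropositionalEquality using (_≡_)
open import Relation.Nullary using (¬_)

IsPerm : List ℕ → Set
IsPerm π = π ↭ map suc (upTo (length π))

Perm : ℕ → Set
Perm k = Σ (List ℕ) λ σ → (length σ ≡ k) × IsPerm σ

rank : ℕ → List ℕ → ℕ
rank x xs = length (filter (_≤? x) xs)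

std : List ℕ → List ℕ
std xs = map (λ x → rank x xs) xs

SameOrder : List ℕ → List ℕ → Set
SameOrder xs ys = std xs ≡ std ys

Contains : List ℕ → List ℕ → Set
Contains σ τ = ∃[ ys ] (ys ⊆ τ × SameOrder ys σ)

Avoids : List ℕ → List ℕ → Set
Avoids σ τ = ¬ Contains σ τ

ContainsConsec : List ℕ → List ℕ → Set
ContainsConsec σ τ = ∃[ as ] ∃[ ys ] ∃[ bs ] (τ ≡ as ++ ys ++ bs × SameOrder ys σ)

AvoidsConsec : List ℕ → List ℕ → Set
AvoidsConsec σ τ = ¬ ContainsConsec σ τ

eqList : List ℕ → List ℕ → Bool
eqList [] [] = true
eqList (x ∷ xs) (y ∷ ys) = (x ≡ᵇ y) ∧ eqList xs ys
eqList _ _ = false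

prefixes : List ℕ → List (List ℕ)
prefixes [] = [] ∷ []
prefixes (x ∷ xs) = [] ∷ map (x ∷_) (prefixes xs)

factors : List ℕ → List (List ℕ)
factors [] = [] ∷ []
factors (x ∷ xs) = prefixes (x ∷ xs) ++ factors xs

containsConsecᵇ : List ℕ → List ℕ → Bool
containsConsecᵇ σ τ = any (λ ys → eqList (std ys) (std σ)) (factors τ)

-- The stack machine T_A, where membership of the stack word in A is given
-- by a Boolean test 'inA' (applied to the stack read top to bottom).
-- Arguments: fuel, remaining input, stack (top first).
-- With fuel 2n on an input of length n, the machine finishes
-- (each step is one push or one pop).
runStack : (List ℕ → Bool) → ℕ → List ℕ → List ℕ → List ℕ
runStack inA zero _ _ = []
runStack inA (suc f) [] [] = []
runStack inA (suc f) [] (s ∷ st) = s ∷ runStack inA f [] st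
runStack inA (suc f) (x ∷ xs) [] = runStack inA f xs (x ∷ [])
runStack inA (suc f) (x ∷ xs) (s ∷ st) =
  if inA (x ∷ s ∷ st)
  then runStack inA f xs (x ∷ s ∷ st)
  else s ∷ runStack inA f (x ∷ xs) st

T : (List ℕ → Bool) → List ℕ → List ℕ
T inA π = runStack inA (2 * length π) π []

-- SC_σ : A = permutations avoiding σ consecutively; the stack word has the
-- same relative order as an element of A iff its standardization avoids σ
-- consecutively.
SC : List ℕ → List ℕ → List ℕ
SC σ = T (λ w → not (containsConsecᵇ σ (std w)))

InSort : List ℕ → List ℕ → Set
InSort σ π = Avoids (2 ∷ 3 ∷ 1 ∷ []) (SC σ π)

hat : List ℕ → List ℕ
hat (a ∷ b ∷ rest) = b ∷ a ∷ rest
hat σ = σ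

-- If π avoids rev(σ) consecutively, SC_σ never refuses a push: when x is pushed, the stack
-- read top to bottom is the reverse of the prefix of π ending at x.  Hence SC_σ(π) = rev(π),
-- which avoids 231 exactly when π avoids 132.
-- If π contains rev(σ) consecutively, some push is eventually refused.  The stack always
-- avoids σ, so a refused push of x onto s ⋯ creates an occurrence x s ρ ≅ σ at the top;
-- s is popped.  At the last refusal of x, x is then pushed above ρ, so the output contains
-- s x ρ ≅ σ̂, and hence 231.

module Submission where

open import Defs
open import Data.Bool using (Bool; true; false; not) renaming (T to IsTrue)
open import Data.Bool.Properties using (T-≡; T-∧; not-injective)
open import Data.Empty using (⊥-elim)
open import Data.List using (List; []; _∷_; [_]; _++_; _ʳ++_; length; map; reverse; zip)
open import Data.List.Properties
  using (map-∘; map-id; map-cong; map-cong-local; map-++; length-map; ++-assoc; ++-identityʳ;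
         ∷-injectiveˡ; ∷-injectiveʳ; reverse-++; reverse-map; reverse-involutive; unfold-reverse;
         filter-accept; filter-reject)
open import Data.List.Membership.Propositional using (_∈_; find; lose)
open import Data.List.Membership.Propositional.Properties
  using (∈-∃++; ∈-map⁻; ∈-map⁺; ∈-++⁺ˡ; ∈-++⁺ʳ; ∈-++⁻)
open import Data.List.Relation.Unary.All as All using (All; []; _∷_)
open import Data.List.Relation.Unary.Any using (here; there)
open import Data.List.Relation.Unary.Any.Properties using (any⁺; any⁻)
open import Data.List.Relation.Binary.Sublist.Propositional
  using (_⊆_; []; _∷_; _∷ʳ_; ⊆-refl; ⊆-trans; minimum)
open import Data.List.Relation.Binary.Sublist.Propositional.Properties
  using (filter⁺; length-mono-≤; ++⁺ʳ; ++⁺ˡ; reverse⁺; map⁺; Any-resp-⊆)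
open import Data.List.Relation.Binary.Permutation.Propositional using (_↭_; ↭-refl; ↭-swap)
open import Data.List.Relation.Binary.Permutation.Propositional.Properties
  using (filter-↭; ↭-length; ↭-reverse; shift)
open import Data.Nat using (ℕ; zero; suc; _+_; _*_; _≥_; _≤_; _<_; _≤?_; z≤n; s≤s)
open import Data.Nat.Properties
  using (+-suc; *-suc; +-identityʳ; ≤-refl; ≤-reflexive; ≤-trans; ≤-pred; <⇒≤; <⇒≱; ≰⇒>;
         suc-injective; ≡ᵇ⇒≡; ≡⇒≡ᵇ; module ≤-Reasoning)
open import Data.Product using (_×_; _,_; proj₁; proj₂; ∃-syntax; ∃₂)
open import Data.Sum using (inj₁; inj₂)
open import Function using (_∘_; id)
open import Function.Bundles using (_⇔_; mk⇔; Equivalence)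
open import Function.Construct.Composition using (_⇔-∘_)
open import Function.Construct.Symmetry using (⇔-sym)
open import Relation.Binary.PropositionalEquality
  using (_≡_; refl; sym; trans; cong; cong₂; subst; subst₂; module ≡-Reasoning)
open import Relation.Nullary using (¬_; yes; no)

open Equivalence using (to; from)


-- Ranks and standardisation

rank-∷-≤ : ∀ {a x} (l : List ℕ) → a ≤ x → rank x (a ∷ l) ≡ suc (rank x l)
rank-∷-≤ {x = x} l a≤x = cong length (filter-accept (_≤? x) a≤x)

rank-∷-≰ : ∀ {a x} (l : List ℕ) → ¬ a ≤ x → rank x (a ∷ l) ≡ rank x l
rank-∷-≰ {x = x} l a≰x = cong length (filter-reject (_≤? x) a≰x)

rank-↭ : ∀ {x} {l m : List ℕ} → l ↭ m → rank x l ≡ rank x m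
rank-↭ {x} l↭m = ↭-length (filter-↭ (_≤? x) l↭m)

rank-mono : ∀ {x y} (l : List ℕ) → x ≤ y → rank x l ≤ rank y l
rank-mono {x} {y} l x≤y =
  length-mono-≤ (filter⁺ (_≤? x) (_≤? y) (λ { refl a≤x → ≤-trans a≤x x≤y }) (⊆-refl {x = l}))

rank-mono-< : ∀ {x y} (l : List ℕ) → y < x → x ∈ l → rank y l < rank x l
rank-mono-< {x} {y} l y<x x∈l with ys , zs , refl ← ∈-∃++ x∈l = begin-strict
  rank y (ys ++ [ x ] ++ zs)  ≡⟨ rank-↭ (shift x ys zs) ⟩
  rank y (x ∷ ys ++ zs)       ≡⟨ rank-∷-≰ (ys ++ zs) (<⇒≱ y<x) ⟩
  rank y (ys ++ zs)           ≤⟨ rank-mono (ys ++ zs) (<⇒≤ y<x) ⟩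
  rank x (ys ++ zs)           <⟨ s≤s ≤-refl ⟩
  suc (rank x (ys ++ zs))     ≡⟨ rank-∷-≤ (ys ++ zs) ≤-refl ⟨
  rank x (x ∷ ys ++ zs)       ≡⟨ rank-↭ (shift x ys zs) ⟨
  rank x (ys ++ [ x ] ++ zs)  ∎
  where open ≤-Reasoning

rank-≤⇔ : ∀ {x y} {l : List ℕ} → x ∈ l → x ≤ y ⇔ rank x l ≤ rank y l
rank-≤⇔ {x} {y} {l} x∈l = mk⇔ (rank-mono l) reflect
  where
  reflect : rank x l ≤ rank y l → x ≤ y
  reflect r with x ≤? y
  ... | yes x≤y = x≤y
  ... | no x≰y = ⊥-elim (<⇒≱ (rank-mono-< l (≰⇒> x≰y) x∈l) r)

↭-hat : (l : List ℕ) → hat l ↭ l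
↭-hat [] = ↭-refl
↭-hat (a ∷ []) = ↭-refl
↭-hat (a ∷ b ∷ l) = ↭-swap b a ↭-refl

map-hat : (f : ℕ → ℕ) (l : List ℕ) → map f (hat l) ≡ hat (map f l)
map-hat f [] = refl
map-hat f (a ∷ []) = refl
map-hat f (a ∷ b ∷ l) = refl

std-reverse : (l : List ℕ) → std (reverse l) ≡ reverse (std l)
std-reverse l =
  trans (map-cong (λ x → rank-↭ (↭-reverse l)) (reverse l)) (reverse-map (λ x → rank x l) l)

std-hat : (l : List ℕ) → std (hat l) ≡ hat (std l)
std-hat l = trans (map-cong (λ x → rank-↭ (↭-hat l)) (hat l)) (map-hat (λ x → rank x l) l)

SameOrder-reverse : ∀ {xs ys} → SameOrder xs ys → SameOrder (reverse xs) (reverse ys)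
SameOrder-reverse {xs} {ys} e =
  trans (std-reverse xs) (trans (cong reverse e) (sym (std-reverse ys)))

SameOrder-hat : ∀ {xs ys} → SameOrder xs ys → SameOrder (hat xs) (hat ys)
SameOrder-hat {xs} {ys} e = trans (std-hat xs) (trans (cong hat e) (sym (std-hat ys)))

SameOrder-length : ∀ {xs ys} → SameOrder xs ys → length xs ≡ length ys
SameOrder-length {xs} {ys} e =
  trans (sym (length-map _ xs)) (trans (cong length e) (length-map _ ys))


-- Classical containment

Concordant : List (ℕ × ℕ) → Set
Concordant ps = ∀ {p q} → p ∈ ps → q ∈ ps → proj₁ p ≤ proj₁ q ⇔ proj₂ p ≤ proj₂ q

Concordant-⊆ : ∀ {qs ps} → qs ⊆ ps → Concordant ps → Concordant qs
Concordant-⊆ qs⊆ps c p∈qs q∈qs = c (Any-resp-⊆ qs⊆ps p∈qs) (Any-resp-⊆ qs⊆ps q∈qs)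

rank-concordant : ∀ {ps p} → Concordant ps → p ∈ ps → ∀ rs → All (_∈ ps) rs →
                  rank (proj₁ p) (map proj₁ rs) ≡ rank (proj₂ p) (map proj₂ rs)
rank-concordant c p∈ps [] [] = refl
rank-concordant {p = p} c p∈ps (r ∷ rs) (r∈ps ∷ rs∈ps) with proj₁ r ≤? proj₁ p
... | yes r≤p
  rewrite rank-∷-≤ (map proj₁ rs) r≤p | rank-∷-≤ (map proj₂ rs) (to (c r∈ps p∈ps) r≤p)
  = cong suc (rank-concordant c p∈ps rs rs∈ps)
... | no r≰p
  rewrite rank-∷-≰ (map proj₁ rs) r≰p | rank-∷-≰ (map proj₂ rs) (r≰p ∘ from (c r∈ps p∈ps))
  = rank-concordant c p∈ps rs rs∈ps

concordant⇒SameOrder : ∀ {ps} → Concordant ps → SameOrder (map proj₁ ps) (map proj₂ ps)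
concordant⇒SameOrder {ps} c = begin
  std (map proj₁ ps)                             ≡⟨ map-∘ ps ⟨
  map (λ p → rank (proj₁ p) (map proj₁ ps)) ps   ≡⟨ map-cong-local (All.tabulate pointwise) ⟩
  map (λ p → rank (proj₂ p) (map proj₂ ps)) ps   ≡⟨ map-∘ ps ⟩
  std (map proj₂ ps)                             ∎
  where
  open ≡-Reasoning
  pointwise : ∀ {p} → p ∈ ps → rank (proj₁ p) (map proj₁ ps) ≡ rank (proj₂ p) (map proj₂ ps)
  pointwise p∈ps = rank-concordant c p∈ps ps (All.tabulate id)

SameOrder-map : ∀ (f : ℕ → ℕ) ys → (∀ {x y} → x ∈ ys → y ∈ ys → x ≤ y ⇔ f x ≤ f y) →
                SameOrder (map f ys) ys
SameOrder-map f ys f-embeds = begin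
  std (map f ys)                                ≡⟨ cong std (map-∘ ys) ⟩
  std (map proj₁ (map (λ x → f x , x) ys))      ≡⟨ concordant⇒SameOrder concordant ⟩
  std (map proj₂ (map (λ x → f x , x) ys))      ≡⟨ cong std (trans (sym (map-∘ ys)) (map-id ys)) ⟩
  std ys                                        ∎
  where
  open ≡-Reasoning
  concordant : Concordant (map (λ x → f x , x) ys)
  concordant p∈ q∈ with x , x∈ys , refl ← ∈-map⁻ _ p∈ | y , y∈ys , refl ← ∈-map⁻ _ q∈ =
    ⇔-sym (f-embeds x∈ys y∈ys)

∈-zip⁻ : ∀ {f g : ℕ → ℕ} {x y} xs ys → map f xs ≡ map g ys → (x , y) ∈ zip xs ys →
         f x ≡ g y × x ∈ xs × y ∈ ys
∈-zip⁻ (x ∷ xs) (y ∷ ys) e (here refl) = ∷-injectiveˡ e , here refl , here refl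
∈-zip⁻ (x ∷ xs) (y ∷ ys) e (there p∈zip) with ∈-zip⁻ xs ys (∷-injectiveʳ e) p∈zip
... | fx≡gy , x∈xs , y∈ys = fx≡gy , there x∈xs , there y∈ys

SameOrder⇒concordant : ∀ {xs ys} → SameOrder xs ys → Concordant (zip xs ys)
SameOrder⇒concordant {xs} {ys} e {x , y} {x′ , y′} p∈zip q∈zip
  with ∈-zip⁻ xs ys e p∈zip | ∈-zip⁻ xs ys e q∈zip
... | rx≡ry , x∈xs , y∈ys | rx′≡ry′ , _ , _ =
  ⇔-sym (rank-≤⇔ y∈ys) ⇔-∘
  subst₂ (λ a b → x ≤ x′ ⇔ a ≤ b) rx≡ry rx′≡ry′ (rank-≤⇔ x∈xs)

map-proj₁-zip : ∀ (xs ys : List ℕ) → length xs ≡ length ys → map proj₁ (zip xs ys) ≡ xs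
map-proj₁-zip [] [] _ = refl
map-proj₁-zip (x ∷ xs) (y ∷ ys) e = cong (x ∷_) (map-proj₁-zip xs ys (suc-injective e))

map-proj₂-zip : ∀ (xs ys : List ℕ) → length xs ≡ length ys → map proj₂ (zip xs ys) ≡ ys
map-proj₂-zip [] [] _ = refl
map-proj₂-zip (x ∷ xs) (y ∷ ys) e = cong (y ∷_) (map-proj₂-zip xs ys (suc-injective e))

⊆-map-lift : ∀ {A B : Set} (f : A → B) (ps : List A) {zs} → zs ⊆ map f ps →
             ∃[ qs ] (qs ⊆ ps × map f qs ≡ zs)
⊆-map-lift f [] [] = [] , [] , refl
⊆-map-lift f (p ∷ ps) (_ ∷ʳ zs⊆) with qs , qs⊆ps , e ← ⊆-map-lift f ps zs⊆ =
  qs , p ∷ʳ qs⊆ps , e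
⊆-map-lift f (p ∷ ps) (refl ∷ zs⊆) with qs , qs⊆ps , e ← ⊆-map-lift f ps zs⊆ =
  p ∷ qs , refl ∷ qs⊆ps , cong (f p ∷_) e

SameOrder-⊆ : ∀ {xs ys zs} → SameOrder xs ys → zs ⊆ ys → ∃[ ws ] (ws ⊆ xs × SameOrder ws zs)
SameOrder-⊆ {xs} {ys} {zs} e zs⊆ys
  with len ← SameOrder-length e
  with qs , qs⊆zip , refl ←
         ⊆-map-lift proj₂ (zip xs ys) (subst (zs ⊆_) (sym (map-proj₂-zip xs ys len)) zs⊆ys)
  = map proj₁ qs
  , subst (map proj₁ qs ⊆_) (map-proj₁-zip xs ys len) (map⁺ proj₁ qs⊆zip)
  , concordant⇒SameOrder (Concordant-⊆ qs⊆zip (SameOrder⇒concordant e))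

Contains-∷ : ∀ {τ π} x → Contains τ π → Contains τ (x ∷ π)
Contains-∷ x (ys , ys⊆π , ys≈τ) = ys , x ∷ʳ ys⊆π , ys≈τ

Contains-trans : ∀ {τ υ π} → Contains τ υ → Contains υ π → Contains τ π
Contains-trans (ys , ys⊆υ , ys≈τ) (zs , zs⊆π , zs≈υ)
  with ws , ws⊆zs , ws≈ys ← SameOrder-⊆ zs≈υ ys⊆υ
  = ws , ⊆-trans ws⊆zs zs⊆π , trans ws≈ys ys≈τ

Contains-reverse : ∀ {τ π} → Contains τ π → Contains (reverse τ) (reverse π)
Contains-reverse (ys , ys⊆π , ys≈τ) = reverse ys , reverse⁺ ys⊆π , SameOrder-reverse ys≈τ

Contains-reverse⁻ : ∀ {τ π} → Contains τ (reverse π) → Contains (reverse τ) π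
Contains-reverse⁻ {τ} {π} c =
  subst (Contains (reverse τ)) (reverse-involutive π) (Contains-reverse c)


-- Consecutive containment

factor-⊆ : ∀ (as ys bs : List ℕ) → ys ⊆ as ++ ys ++ bs
factor-⊆ as ys bs = ++⁺ˡ as (++⁺ʳ bs ⊆-refl)

ContainsConsec-length : ∀ {τ w} → ContainsConsec τ w → length τ ≤ length w
ContainsConsec-length (as , ys , bs , refl , ys≈τ) =
  subst (_≤ _) (SameOrder-length ys≈τ) (length-mono-≤ (factor-⊆ as ys bs))

ContainsConsec-∷ : ∀ {τ w} x → ContainsConsec τ w → ContainsConsec τ (x ∷ w)
ContainsConsec-∷ x (as , ys , bs , refl , ys≈τ) = x ∷ as , ys , bs , refl , ys≈τ

ContainsConsec-++ : ∀ {τ w} v → ContainsConsec τ w → ContainsConsec τ (w ++ v)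
ContainsConsec-++ v (as , ys , bs , refl , ys≈τ) =
  as , ys , bs ++ v , trans (++-assoc as (ys ++ bs) v) (cong (as ++_) (++-assoc ys bs v)) , ys≈τ

ContainsConsec-reverse : ∀ {τ w} → ContainsConsec τ w → ContainsConsec (reverse τ) (reverse w)
ContainsConsec-reverse (as , ys , bs , refl , ys≈τ) =
  reverse bs , reverse ys , reverse as , split , SameOrder-reverse ys≈τ
  where
  open ≡-Reasoning
  split : reverse (as ++ ys ++ bs) ≡ reverse bs ++ reverse ys ++ reverse as
  split = begin
    reverse (as ++ ys ++ bs)                 ≡⟨ reverse-++ as (ys ++ bs) ⟩
    reverse (ys ++ bs) ++ reverse as         ≡⟨ cong (_++ reverse as) (reverse-++ ys bs) ⟩
    (reverse bs ++ reverse ys) ++ reverse as ≡⟨ ++-assoc (reverse bs) (reverse ys) (reverse as) ⟩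
    reverse bs ++ reverse ys ++ reverse as   ∎

ContainsConsec-reverse⁻ : ∀ {τ w} → ContainsConsec (reverse τ) w → ContainsConsec τ (reverse w)
ContainsConsec-reverse⁻ {τ} c =
  subst (λ υ → ContainsConsec υ _) (reverse-involutive τ) (ContainsConsec-reverse c)

ContainsConsec-head : ∀ {τ x w} → ContainsConsec τ (x ∷ w) → AvoidsConsec τ w →
                      ∃₂ λ ys bs → x ∷ w ≡ ys ++ bs × SameOrder ys τ
ContainsConsec-head ([] , ys , bs , e , ys≈τ) _ = ys , bs , e , ys≈τ
ContainsConsec-head (a ∷ as , ys , bs , e , ys≈τ) w-avoids =
  ⊥-elim (w-avoids (as , ys , bs , ∷-injectiveʳ e , ys≈τ))

map-++⁻ : ∀ (f : ℕ → ℕ) w as bs → map f w ≡ as ++ bs →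
          ∃₂ λ w₁ w₂ → w ≡ w₁ ++ w₂ × map f w₁ ≡ as × map f w₂ ≡ bs
map-++⁻ f w [] bs e = [] , w , refl , refl , e
map-++⁻ f (x ∷ w) (a ∷ as) bs e
  with w₁ , w₂ , refl , e₁ , e₂ ← map-++⁻ f w as bs (∷-injectiveʳ e)
  = x ∷ w₁ , w₂ , refl , cong₂ _∷_ (∷-injectiveˡ e) e₁ , e₂

SameOrder-std-factor : ∀ {ys w} → ys ⊆ w → SameOrder (map (λ x → rank x w) ys) ys
SameOrder-std-factor {ys} {w} ys⊆w =
  SameOrder-map (λ x → rank x w) ys (λ x∈ys _ → rank-≤⇔ (Any-resp-⊆ ys⊆w x∈ys))

ContainsConsec-std⁻ : ∀ {τ w} → ContainsConsec τ (std w) → ContainsConsec τ w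
ContainsConsec-std⁻ {w = w} (as , ys , bs , e , ys≈τ)
  with w₁ , w₂ , refl , refl , e₂ ← map-++⁻ (λ x → rank x w) w as (ys ++ bs) e
  with w₃ , w₄ , refl , refl , refl ← map-++⁻ (λ x → rank x (w₁ ++ w₂)) w₂ ys bs e₂
  = w₁ , w₃ , w₄ , refl , trans (sym (SameOrder-std-factor (factor-⊆ w₁ w₃ w₄))) ys≈τ

ContainsConsec-std⁺ : ∀ {τ w} → ContainsConsec τ w → ContainsConsec τ (std w)
ContainsConsec-std⁺ (as , ys , bs , refl , ys≈τ) =
  map f as , map f ys , map f bs , trans (map-++ f as _) (cong (map f as ++_) (map-++ f ys bs)) ,
  trans (SameOrder-std-factor (factor-⊆ as ys bs)) ys≈τ
  where f = λ x → rank x (as ++ ys ++ bs)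

eqList-refl : ∀ xs → IsTrue (eqList xs xs)
eqList-refl [] = _
eqList-refl (x ∷ xs) = from T-∧ (≡⇒≡ᵇ x x refl , eqList-refl xs)

eqList-sound : ∀ xs ys → IsTrue (eqList xs ys) → xs ≡ ys
eqList-sound [] [] _ = refl
eqList-sound (x ∷ xs) (y ∷ ys) t with x≡ᵇy , xs≡ys ← to T-∧ t =
  cong₂ _∷_ (≡ᵇ⇒≡ x y x≡ᵇy) (eqList-sound xs ys xs≡ys)

∈-prefixes⁻ : ∀ l {ys} → ys ∈ prefixes l → ∃[ bs ] l ≡ ys ++ bs
∈-prefixes⁻ [] (here refl) = [] , refl
∈-prefixes⁻ (x ∷ l) (here refl) = x ∷ l , refl
∈-prefixes⁻ (x ∷ l) (there ys∈)
  with zs , zs∈ , refl ← ∈-map⁻ (x ∷_) ys∈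
  with bs , e ← ∈-prefixes⁻ l zs∈
  = bs , cong (x ∷_) e

∈-prefixes⁺ : ∀ ys bs → ys ∈ prefixes (ys ++ bs)
∈-prefixes⁺ [] [] = here refl
∈-prefixes⁺ [] (b ∷ bs) = here refl
∈-prefixes⁺ (y ∷ ys) bs = there (∈-map⁺ (y ∷_) (∈-prefixes⁺ ys bs))

∈-factors⁻ : ∀ l {ys} → ys ∈ factors l → ∃₂ λ as bs → l ≡ as ++ ys ++ bs
∈-factors⁻ [] (here refl) = [] , [] , refl
∈-factors⁻ (x ∷ l) ys∈ with ∈-++⁻ (prefixes (x ∷ l)) ys∈
... | inj₁ ys∈prefixes with bs , e ← ∈-prefixes⁻ (x ∷ l) ys∈prefixes = [] , bs , e
... | inj₂ ys∈factors with as , bs , e ← ∈-factors⁻ l ys∈factors = x ∷ as , bs , cong (x ∷_) e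

∈-factors⁺ : ∀ as ys bs → ys ∈ factors (as ++ ys ++ bs)
∈-factors⁺ [] [] [] = here refl
∈-factors⁺ [] [] (b ∷ bs) = here refl
∈-factors⁺ [] (y ∷ ys) bs = ∈-++⁺ˡ (∈-prefixes⁺ (y ∷ ys) bs)
∈-factors⁺ (a ∷ as) ys bs = ∈-++⁺ʳ (prefixes (a ∷ as ++ ys ++ bs)) (∈-factors⁺ as ys bs)

containsConsecᵇ-sound : ∀ σ w → IsTrue (containsConsecᵇ σ (std w)) → ContainsConsec σ w
containsConsecᵇ-sound σ w t
  with ys , ys∈ , ys≈σ ← find (any⁻ (λ ys → eqList (std ys) (std σ)) (factors (std w)) t)
  with as , bs , e ← ∈-factors⁻ (std w) ys∈
  = ContainsConsec-std⁻ (as , ys , bs , e , eqList-sound _ _ ys≈σ)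

containsConsecᵇ-complete : ∀ σ w → ContainsConsec σ w → IsTrue (containsConsecᵇ σ (std w))
containsConsecᵇ-complete σ w c with as , ys , bs , e , ys≈σ ← ContainsConsec-std⁺ c =
  any⁺ _ (lose (subst (λ l → ys ∈ factors l) (sym e) (∈-factors⁺ as ys bs))
               (subst (λ l → IsTrue (eqList l (std σ))) (sym ys≈σ) (eqList-refl (std σ))))


-- The stack machine

-- Each step is one push or one pop, so 2 |input| + |stack| steps suffice.
record Enough (f : ℕ) (xs st : List ℕ) : Set where
  constructor enough
  field bound : 2 * length xs + length st ≤ f

enough-push : ∀ {f x xs st} → Enough (suc f) (x ∷ xs) st → Enough f xs (x ∷ st)
enough-push {f} {x} {xs} {st} (enough e) = enough (≤-pred (subst (_≤ suc f) push-cost e))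
  where
  push-cost : 2 * length (x ∷ xs) + length st ≡ suc (2 * length xs + length (x ∷ st))
  push-cost = trans (cong (_+ length st) (*-suc 2 (length xs)))
                    (cong suc (sym (+-suc (2 * length xs) (length st))))

enough-pop : ∀ {f xs s st} → Enough (suc f) xs (s ∷ st) → Enough f xs st
enough-pop {f} {xs} {s} {st} (enough e) =
  enough (≤-pred (subst (_≤ suc f) (+-suc (2 * length xs) (length st)) e))

enough-start : ∀ π → Enough (2 * length π) π []
enough-start π = enough (≤-reflexive (+-identityʳ (2 * length π)))

module _ (accepts : List ℕ → Bool) where

  stack⊆output : ∀ f xs st → Enough f xs st → st ⊆ runStack accepts f xs st
  stack⊆output zero [] [] _ = []
  stack⊆output zero [] (s ∷ st) (enough ())
  stack⊆output zero (x ∷ xs) st (enough ())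
  stack⊆output (suc f) [] [] _ = []
  stack⊆output (suc f) [] (s ∷ st) e = refl ∷ stack⊆output f [] st (enough-pop e)
  stack⊆output (suc f) (x ∷ xs) [] e = minimum _
  stack⊆output (suc f) (x ∷ xs) (s ∷ st) e with accepts (x ∷ s ∷ st)
  ... | true = ⊆-trans (x ∷ʳ ⊆-refl) (stack⊆output f xs (x ∷ s ∷ st) (enough-push e))
  ... | false = refl ∷ stack⊆output f (x ∷ xs) st (enough-pop e)

  -- x ∷ a ʳ++ st is the stack at the moment x is pushed, a having been pushed before it.
  runStack-pushAll : ∀ f xs st → (∀ a x b → xs ≡ a ++ x ∷ b → accepts (x ∷ a ʳ++ st) ≡ true) →
                     Enough f xs st → runStack accepts f xs st ≡ xs ʳ++ st
  runStack-pushAll zero [] [] _ _ = refl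
  runStack-pushAll zero [] (s ∷ st) _ (enough ())
  runStack-pushAll zero (x ∷ xs) st _ (enough ())
  runStack-pushAll (suc f) [] [] _ _ = refl
  runStack-pushAll (suc f) [] (s ∷ st) _ e =
    cong (s ∷_) (runStack-pushAll f [] st (λ { [] _ _ () ; (_ ∷ _) _ _ () }) (enough-pop e))
  runStack-pushAll (suc f) (x ∷ xs) [] pushes e =
    runStack-pushAll f xs [ x ] (λ a y b eq → pushes (x ∷ a) y b (cong (x ∷_) eq)) (enough-push e)
  runStack-pushAll (suc f) (x ∷ xs) (s ∷ st) pushes e rewrite pushes [] x xs refl =
    runStack-pushAll f xs (x ∷ s ∷ st) (λ a y b eq → pushes (x ∷ a) y b (cong (x ∷_) eq))
                     (enough-push e)


acceptsSC : List ℕ → List ℕ → Bool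
acceptsSC σ w = not (containsConsecᵇ σ (std w))

module _ (σ : List ℕ) where

  rejectsSC⇒containsConsec : ∀ w → acceptsSC σ w ≡ false → ContainsConsec σ w
  rejectsSC⇒containsConsec w r = containsConsecᵇ-sound σ w (from T-≡ (not-injective r))

  acceptsSC⇒avoidsConsec : ∀ w → acceptsSC σ w ≡ true → AvoidsConsec σ w
  acceptsSC⇒avoidsConsec w a c with containsConsecᵇ σ (std w) | containsConsecᵇ-complete σ w c
  acceptsSC⇒avoidsConsec w () _ | true | _

  avoidsConsec⇒acceptsSC : ∀ w → AvoidsConsec σ w → acceptsSC σ w ≡ true
  avoidsConsec⇒acceptsSC w av with containsConsecᵇ σ (std w) in eq
  ... | true = ⊥-elim (av (containsConsecᵇ-sound σ w (from T-≡ eq)))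
  ... | false = refl

  SC-reverse : ∀ π → AvoidsConsec (reverse σ) π → SC σ π ≡ reverse π
  SC-reverse π av = runStack-pushAll (acceptsSC σ) (2 * length π) π [] pushes (enough-start π)
    where
    pushes : ∀ a x b → π ≡ a ++ x ∷ b → acceptsSC σ (x ∷ a ʳ++ []) ≡ true
    pushes a x b refl = avoidsConsec⇒acceptsSC (x ∷ reverse a) λ c →
      av (subst (ContainsConsec (reverse σ)) prefix (ContainsConsec-++ b (ContainsConsec-reverse c)))
      where
      prefix : reverse (x ∷ reverse a) ++ b ≡ a ++ x ∷ b
      prefix = begin
        reverse (x ∷ reverse a) ++ b        ≡⟨ cong (_++ b) (unfold-reverse x (reverse a)) ⟩
        (reverse (reverse a) ++ [ x ]) ++ b ≡⟨ cong (λ l → (l ++ [ x ]) ++ b) (reverse-involutive a) ⟩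
        (a ++ [ x ]) ++ b                   ≡⟨ ++-assoc a [ x ] b ⟩
        a ++ x ∷ b                          ∎
        where open ≡-Reasoning

module _ (c d : ℕ) (q : List ℕ) where

  private
    σ : List ℕ
    σ = c ∷ d ∷ q

  avoidsConsec-short : ∀ w → length w ≤ 1 → AvoidsConsec σ w
  avoidsConsec-short w len cc with ≤-trans (ContainsConsec-length {σ} cc) len
  ... | s≤s ()

  rejected⇒hat-occurrence : ∀ x s st → acceptsSC σ (x ∷ s ∷ st) ≡ false → AvoidsConsec σ (s ∷ st) →
                            ∃[ rest ] (rest ⊆ st × SameOrder (s ∷ x ∷ rest) (hat σ))
  rejected⇒hat-occurrence x s st r av
    with ContainsConsec-head {σ} (rejectsSC⇒containsConsec σ (x ∷ s ∷ st) r) av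
  ... | [] , _ , _ , ()
  ... | _ ∷ [] , _ , _ , ()
  ... | _ ∷ _ ∷ rest , bs , refl , ys≈σ =
    rest , ++⁺ʳ bs ⊆-refl , SameOrder-hat {x ∷ s ∷ rest} {σ} ys≈σ

  pushed⇒hat : ∀ {x s st rest out} → rest ⊆ st → SameOrder (s ∷ x ∷ rest) (hat σ) →
               x ∷ st ⊆ out → Contains (hat σ) (s ∷ out)
  pushed⇒hat rest⊆st so x∷st⊆out = _ , refl ∷ ⊆-trans (refl ∷ rest⊆st) x∷st⊆out , so

  rejected⇒hat : ∀ f x xs s st → acceptsSC σ (x ∷ s ∷ st) ≡ false → AvoidsConsec σ (s ∷ st) →
                 Enough f (x ∷ xs) st → Contains (hat σ) (s ∷ runStack (acceptsSC σ) f (x ∷ xs) st)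
  rejected⇒hat zero x xs s st _ _ (enough ())
  rejected⇒hat (suc f) x xs s [] r av en
    with rest , rest⊆st , so ← rejected⇒hat-occurrence x s [] r av
    = pushed⇒hat rest⊆st so (stack⊆output (acceptsSC σ) f xs [ x ] (enough-push en))
  rejected⇒hat (suc f) x xs s (t ∷ st) r av en with acceptsSC σ (x ∷ t ∷ st) in eq
  ... | true with rest , rest⊆st , so ← rejected⇒hat-occurrence x s (t ∷ st) r av =
    pushed⇒hat rest⊆st so (stack⊆output (acceptsSC σ) f xs (x ∷ t ∷ st) (enough-push en))
  ... | false =
    Contains-∷ {hat σ} s (rejected⇒hat f x xs t st eq (av ∘ ContainsConsec-∷ {σ} s) (enough-pop en))

  -- The occurrence of σ that pushing all of a would create is never completed on the stack,
  -- so one of these pushes is refused.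
  future-occurrence⇒hat : ∀ f a b st → AvoidsConsec σ st → ContainsConsec σ (a ʳ++ st) →
                          Enough f (a ++ b) st → Contains (hat σ) (runStack (acceptsSC σ) f (a ++ b) st)
  future-occurrence⇒hat f [] b st av cc _ = ⊥-elim (av cc)
  future-occurrence⇒hat zero (x ∷ a) b st _ _ (enough ())
  future-occurrence⇒hat (suc f) (x ∷ a) b [] _ cc en =
    future-occurrence⇒hat f a b [ x ] (avoidsConsec-short [ x ] ≤-refl) cc (enough-push en)
  future-occurrence⇒hat (suc f) (x ∷ a) b (s ∷ st) av cc en with acceptsSC σ (x ∷ s ∷ st) in eq
  ... | true = future-occurrence⇒hat f a b (x ∷ s ∷ st) (acceptsSC⇒avoidsConsec σ (x ∷ s ∷ st) eq) cc
                                     (enough-push en)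
  ... | false = rejected⇒hat f x (a ++ b) s st eq av (enough-pop en)

  SC-contains-hat : ∀ π → ContainsConsec (reverse σ) π → Contains (hat σ) (SC σ π)
  SC-contains-hat _ (as , ys , bs , refl , ys≈) rewrite sym (++-assoc as ys bs) =
    future-occurrence⇒hat _ (as ++ ys) bs [] (avoidsConsec-short [] z≤n) prefix-reversed
                          (enough-start ((as ++ ys) ++ bs))
    where
    prefix-reversed : ContainsConsec σ (reverse (as ++ ys))
    prefix-reversed =
      ContainsConsec-reverse⁻ {σ} (as , ys , [] , cong (as ++_) (sym (++-identityʳ ys)) , ys≈)

  InSort-SC⇔ : Contains (2 ∷ 3 ∷ 1 ∷ []) (hat σ) → ∀ π →
               InSort σ π ⇔ (Avoids (1 ∷ 3 ∷ 2 ∷ []) π × AvoidsConsec (reverse σ) π)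
  InSort-SC⇔ 231⊑hatσ π = mk⇔ sorted⇒ ⇒sorted
    where
    sorted⇒ : InSort σ π → Avoids (1 ∷ 3 ∷ 2 ∷ []) π × AvoidsConsec (reverse σ) π
    sorted⇒ sorted = avoids-132 , avoids-revσ
      where
      avoids-revσ : AvoidsConsec (reverse σ) π
      avoids-revσ revσ⊑π =
        sorted (Contains-trans {2 ∷ 3 ∷ 1 ∷ []} 231⊑hatσ (SC-contains-hat π revσ⊑π))
      avoids-132 : Avoids (1 ∷ 3 ∷ 2 ∷ []) π
      avoids-132 132⊑π = sorted (subst (Contains (2 ∷ 3 ∷ 1 ∷ [])) (sym (SC-reverse σ π avoids-revσ))
                                       (Contains-reverse {1 ∷ 3 ∷ 2 ∷ []} 132⊑π))
    ⇒sorted : Avoids (1 ∷ 3 ∷ 2 ∷ []) π × AvoidsConsec (reverse σ) π → InSort σ π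
    ⇒sorted (avoids-132 , avoids-revσ) 231⊑SC =
      avoids-132 (Contains-reverse⁻ {2 ∷ 3 ∷ 1 ∷ []}
                   (subst (Contains (2 ∷ 3 ∷ 1 ∷ [])) (SC-reverse σ π avoids-revσ) 231⊑SC))

lemma2p3 : (k : ℕ) → k ≥ 3 → (σ : Perm k) →
    Contains (2 ∷ 3 ∷ 1 ∷ []) (hat (proj₁ σ)) →
    (π : List ℕ) → IsPerm π →
    (InSort (proj₁ σ) π ⇔
      (Avoids (1 ∷ 3 ∷ 2 ∷ []) π × AvoidsConsec (reverse (proj₁ σ)) π))
lemma2p3 _ () ([] , refl , _)
lemma2p3 _ (s≤s ()) (_ ∷ [] , refl , _)
lemma2p3 _ _ (c ∷ d ∷ q , _ , _) 231⊑hatσ π _ = InSort-SC⇔ c d q 231⊑hatσ π
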